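{- Let $m\ge 2$ and let $G_0,\dots,G_{m-1}$ (indices in $\mathbb{Z}_m$) be $4$-graphs with vertex partitions $V(G_i)=V_i'\cup V_i''$. Suppose that for every $i\in\mathbb{Z}_m$ there is an integer $\alpha_i$ with $\alpha(G_i)=\alpha_i+1$ and $\alpha(G_i\cap V_i')\le\alpha_i$. Then $\alpha(C_m[G_0,\dots,G_{m-1}])\le\sum_{i\in\mathbb{Z}_m}\alpha_i$.
   Context: A $4$-graph has a finite vertex set and edges which are $4$-element vertex subsets; $\alpha(\cdot)$ is the maximum size of a vertex set containing no edge; $G\cap U$ denotes the subgraph of $G$ induced by $U$. Circular construction: given $4$-graphs $G_i$, $i\in\mathbb{Z}_m$ ($m\ge2$), with $V(G_i)=V_i'\cup V_i''$ (disjoint), let $W_i=V_i'\times V_{i+1}''$ (the sets $W_i$ regarded as pairwise disjoint), and for $x\in V_i'$ let $W_{i,x}=\{(x,y):y\in V_{i+1}''\}$. For $A\subseteq\bigcup_i W_i$, $\beta_i(A)$ is the number of $x\in V_i'$ with $W_{i,x}\cap A\neq\emptyset$. Define $h_i:W_i\cup W_{i+1}\to V(G_{i+1})$ by $h_i((x,y))=y\in V_{i+1}''$ if $(x,y)\in W_i$ and $h_i((x,y))=x\in V_{i+1}'$ if $(x,y)\in W_{i+1}$. Let $E_i^1$ be the set of $4$-sets $\{w_1,\dots,w_4\}\subseteq W_i\cup W_{i+1}$ with $\beta_i(\{w_1,\dots,w_4\})=1$ such that $h_i(w_1),\dots,h_i(w_4)$ form an edge of $G_{i+1}$. Let $E_i^2$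 be the set of $4$-sets $\{w_1,\dots,w_4\}\subseteq W_i$, $w_j=(x_j,y_j)$, with $x_1=x_2$ and $x_3=x_4\ne x_1$. Let $E_i^4$ be the set of $4$-sets $\{w_1,\dots,w_4\}\subseteq W_i$, $w_j=(x_j,y_j)$, with $x_1,\dots,x_4$ pairwise distinct forming an edge of $G_i$. Then $C_m[G_0,\dots,G_{m-1}]$ is the $4$-graph with vertex set $\bigcup_{i\in\mathbb{Z}_m}W_i$ and edge set $\bigcup_{i\in\mathbb{Z}_m}(E_i^1\cup E_i^2\cup E_i^4)$. -}

module Defs where

open import Data.Nat using (ℕ; zero; suc; _≤_)
open import Data.Nat.DivMod using (_mod_)
open import Data.Nat.ListAction using (sum)
open import Data.Fin using (Fin; toℕ)
open import Data.List using (List; length; tabulate)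
open import Data.List.Membership.Propositional using (_∈_)
open import Data.List.Relation.Unary.Unique.Propositional using (Unique)
open import Data.Maybe using (Maybe; just; nothing)
open import Data.Product using (Σ; ∃; ∃-syntax; _×_; _,_)
open import Data.Sum using (_⊎_; inj₁; inj₂)
open import Relation.Binary.PropositionalEquality using (_≡_; _≢_)
open import Relation.Nullary using (¬_)

Distinct4 : {V : Set} → V → V → V → V → Set
Distinct4 a b c d = a ≢ b × a ≢ c × a ≢ d × b ≢ c × b ≢ d × c ≢ d

-- A 4-graph on vertex type V: the edge {a,b,c,d} is encoded by the predicate
-- Edge a b c d, which only holds for pairwise distinct vertices and is
-- invariant under permutations (generated by adjacent transpositions).
record Graph4 (V : Set) : Set₁ where
  field
    Edge     : V → V → V → V → Set
    distinct : ∀ {a b c d} → Edge a b c d → Distinct4 a b c d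
    sym₁₂    : ∀ {a b c d} → Edge a b c d → Edge b a c d
    sym₂₃    : ∀ {a b c d} → Edge a b c d → Edge a c b d
    sym₃₄    : ∀ {a b c d} → Edge a b c d → Edge a b d c
open Graph4 public

-- A vertex set (given as a duplicate-free list) contains an edge of the
-- 4-uniform hypergraph whose edges are the 4-sets {w₁,w₂,w₃,w₄} (pairwise
-- distinct) such that E w₁ w₂ w₃ w₄ holds for some labelling.
ContainsEdge : {V : Set} → (V → V → V → V → Set) → List V → Set
ContainsEdge {V} E S =
  Σ V λ w₁ → Σ V λ w₂ → Σ V λ w₃ → Σ V λ w₄ →
    w₁ ∈ S × w₂ ∈ S × w₃ ∈ S × w₄ ∈ S × Distinct4 w₁ w₂ w₃ w₄ × E w₁ w₂ w₃ w₄

Independent : {V : Set} → (V → V → V → V → Set) → List V → Set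
Independent E S = Unique S × ¬ ContainsEdge E S

αLe : {V : Set} → (V → V → V → V → Set) → ℕ → Set
αLe {V} E k = (S : List V) → Independent E S → length S ≤ k

αEq : {V : Set} → (V → V → V → V → Set) → ℕ → Set
αEq {V} E k = (Σ (List V) λ S → Independent E S × length S ≡ k) × αLe E k

inducedLeft : {A B : Set} → Graph4 (A ⊎ B) → A → A → A → A → Set
inducedLeft G a b c d = Edge G (inj₁ a) (inj₁ b) (inj₁ c) (inj₁ d)

-- Cyclic successor i ↦ i + 1 in ℤ_m, modelled as Fin m.
next : ∀ {m} → Fin m → Fin m
next {suc n} i = suc (toℕ i) mod suc n

sumFin : ∀ {m} → (Fin m → ℕ) → ℕ
sumFin f = sum (tabulate f)

module Circular {m : ℕ} (a b : Fin m → ℕ)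
                (G : (i : Fin m) → Graph4 (Fin (a i) ⊎ Fin (b i))) where
  -- V_i' = Fin (a i), V_i'' = Fin (b i).
  -- W_i = V_i' × V_{i+1}''
  W : Fin m → Set
  W i = Fin (a i) × Fin (b (next i))

  VC : Set
  VC = Σ (Fin m) W

  Pair : Fin m → Set
  Pair i = W i ⊎ W (next i)

  emb : (i : Fin m) → Pair i → VC
  emb i (inj₁ p) = i , p
  emb i (inj₂ q) = next i , q

  h : (i : Fin m) → Pair i → Fin (a (next i)) ⊎ Fin (b (next i))
  h i (inj₁ (x , y)) = inj₂ y
  h i (inj₂ (x , y)) = inj₁ x

  xOf : (i : Fin m) → Pair i → Maybe (Fin (a i))
  xOf i (inj₁ (x , y)) = just x
  xOf i (inj₂ _)       = nothing

  β≡1 : (i : Fin m) → Pair i → Pair i → Pair i → Pair i → Set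
  β≡1 i u₁ u₂ u₃ u₄ = Σ (Fin (a i)) λ x →
    (xOf i u₁ ≡ just x ⊎ xOf i u₂ ≡ just x ⊎ xOf i u₃ ≡ just x ⊎ xOf i u₄ ≡ just x)
    × (xOf i u₁ ≡ nothing ⊎ xOf i u₁ ≡ just x)
    × (xOf i u₂ ≡ nothing ⊎ xOf i u₂ ≡ just x)
    × (xOf i u₃ ≡ nothing ⊎ xOf i u₃ ≡ just x)
    × (xOf i u₄ ≡ nothing ⊎ xOf i u₄ ≡ just x)

  E1 : VC → VC → VC → VC → Set
  E1 w₁ w₂ w₃ w₄ = Σ (Fin m) λ i →
    Σ (Pair i) λ u₁ → Σ (Pair i) λ u₂ → Σ (Pair i) λ u₃ → Σ (Pair i) λ u₄ →
      w₁ ≡ emb i u₁ × w₂ ≡ emb i u₂ × w₃ ≡ emb i u₃ × w₄ ≡ emb i u₄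
      × β≡1 i u₁ u₂ u₃ u₄
      × Edge (G (next i)) (h i u₁) (h i u₂) (h i u₃) (h i u₄)

  E2 : VC → VC → VC → VC → Set
  E2 w₁ w₂ w₃ w₄ = Σ (Fin m) λ i → Σ (Fin (a i)) λ x → Σ (Fin (a i)) λ x' →
    Σ (Fin (b (next i))) λ y₁ → Σ (Fin (b (next i))) λ y₂ →
    Σ (Fin (b (next i))) λ y₃ → Σ (Fin (b (next i))) λ y₄ →
      x ≢ x'
      × w₁ ≡ (i , (x , y₁)) × w₂ ≡ (i , (x , y₂))
      × w₃ ≡ (i , (x' , y₃)) × w₄ ≡ (i , (x' , y₄))

  E4 : VC → VC → VC → VC → Set
  E4 w₁ w₂ w₃ w₄ = Σ (Fin m) λ i →
    Σ (Fin (a i)) λ x₁ → Σ (Fin (a i)) λ x₂ → Σ (Fin (a i)) λ x₃ → Σ (Fin (a i)) λ x₄ →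
    Σ (Fin (b (next i))) λ y₁ → Σ (Fin (b (next i))) λ y₂ →
    Σ (Fin (b (next i))) λ y₃ → Σ (Fin (b (next i))) λ y₄ →
      w₁ ≡ (i , (x₁ , y₁)) × w₂ ≡ (i , (x₂ , y₂))
      × w₃ ≡ (i , (x₃ , y₃)) × w₄ ≡ (i , (x₄ , y₄))
      × Distinct4 x₁ x₂ x₃ x₄
      × Edge (G i) (inj₁ x₁) (inj₁ x₂) (inj₁ x₃) (inj₁ x₄)

  EC : VC → VC → VC → VC → Set
  EC w₁ w₂ w₃ w₄ = E1 w₁ w₂ w₃ w₄ ⊎ E2 w₁ w₂ w₃ w₄ ⊎ E4 w₁ w₂ w₃ w₄

-- Let S be independent in C = C_m[G_0,…,G_{m-1}], let X_i ⊆ V_i' be the set of x with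
-- W_{i,x} ∩ S ≠ ∅ and β_i = |X_i|.  The edges E_i^4 make X_i independent in G_i ∩ V_i',
-- so β_i ≤ α_i, and the edges E_i^2 allow at most one x* ∈ X_i to have several
-- partners y with (x*, y) ∈ S.  If there is no such x* then |S ∩ W_i| = β_i;
-- otherwise |S ∩ W_i| ≤ (β_i − 1) + |Y|, where Y ⊆ V_{i+1}'' are the partners of x*,
-- and the edges E_i^1 make Y ∪ X_{i+1} independent in G_{i+1}, so |Y| + β_{i+1} ≤ α_{i+1} + 1.
-- Either way |S ∩ W_i| + β_{i+1} ≤ β_i + α_{i+1}, and summing around ℤ_m the β's cancel.
module Submission where

open import Defs
open import Data.Nat using (ℕ; zero; suc; _≤_; _+_; z≤n; s≤s)
open import Data.Nat.Properties
open import Algebra.Properties.CommutativeSemigroup +-commutativeSemigroup using (interchange)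
open import Data.Nat.DivMod using (_%_; m<n⇒m%n≡m; n%n≡0)
open import Data.Nat.ListAction using (sum)
open import Data.Product using (_×_; Σ; ∃; ∃₂; _,_; proj₁; proj₂)
import Data.Product.Properties as Product
open import Data.Fin using (Fin; zero; suc; toℕ; inject₁; fromℕ)
open import Data.Fin.Properties using (toℕ-injective; toℕ-fromℕ<; toℕ-inject₁; toℕ-fromℕ; toℕ<n; any?)
  renaming (_≟_ to _≟ᶠ_)
open import Data.Sum using (_⊎_; inj₁; inj₂)
import Data.Sum as Sum
import Data.Sum.Properties as Sum
open import Data.Maybe using (nothing; just)
open import Data.List using (List; []; _∷_; length; tabulate; filter; map; concat; _++_; allFin)
open import Data.List.Properties using (length-++; length-map; tabulate-cong; filter-notAll)
open import Data.List.Membership.Propositional using (_∈_)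
open import Data.List.Membership.Propositional.Properties
open import Data.List.Relation.Unary.Any using (here; there)
import Data.List.Relation.Unary.Any as Any
import Data.List.Relation.Unary.All as All
open import Data.List.Relation.Unary.Unique.Propositional using (Unique)
import Data.List.Relation.Unary.Unique.Propositional.Properties as Unique
open import Data.List.Relation.Unary.AllPairs using (_∷_)
open import Relation.Binary.PropositionalEquality
open import Relation.Binary.Definitions using (DecidableEquality)
open import Relation.Nullary using (¬_; Dec; yes; no; ¬?)
open import Relation.Nullary.Decidable using (_×-dec_)
open import Data.Empty using (⊥-elim)
open import Function using (_∘_)

module _ {A B : Set} (_≟_ : DecidableEquality B) (f : A → B) where

  length-≤-of-injectiveOn : (xs : List A) (ys : List B) → Unique xs
    → (∀ {u v} → u ∈ xs → v ∈ xs → f u ≡ f v → u ≡ v)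
    → (∀ {u} → u ∈ xs → f u ∈ ys)
    → length xs ≤ length ys
  length-≤-of-injectiveOn [] ys _ _ _ = z≤n
  length-≤-of-injectiveOn (u ∷ xs) ys (u∉xs ∷ xs-unique) injective f∈ys =
    ≤-trans (s≤s (length-≤-of-injectiveOn xs (filter ≢fu? ys) xs-unique
                    (λ p q → injective (there p) (there q)) f∈ys′))
            (filter-notAll ≢fu? ys (Any.map (λ fu≡ fu≢ → fu≢ fu≡) (f∈ys (here refl))))
    where
    ≢fu? = λ y → ¬? (f u ≟ y)
    f∈ys′ : ∀ {v} → v ∈ xs → f v ∈ filter ≢fu? ys
    f∈ys′ v∈xs = ∈-filter⁺ ≢fu? (f∈ys (there v∈xs))
                   (λ fu≡fv → All.lookup u∉xs v∈xs (injective (here refl) (there v∈xs) fu≡fv))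

length-map-++-map : ∀ {A B C : Set} (f : A → C) (g : B → C) (xs : List A) (ys : List B)
  → length (map f xs ++ map g ys) ≡ length xs + length ys
length-map-++-map f g xs ys =
  trans (length-++ (map f xs)) (cong₂ _+_ (length-map f xs) (length-map g ys))

subst₄ : ∀ {A : Set} (P : A → A → A → A → Set) {a b c d a′ b′ c′ d′}
  → a ≡ a′ → b ≡ b′ → c ≡ c′ → d ≡ d′ → P a b c d → P a′ b′ c′ d′
subst₄ P refl refl refl refl p = p

IsInj₂ : ∀ {A B : Set} → A ⊎ B → Set
IsInj₂ {B = B} v = ∃ λ (y : B) → v ≡ inj₂ y

all-inj₁-or-some-inj₂ : ∀ {A B : Set} (v₁ v₂ v₃ v₄ : A ⊎ B)
  → (Σ A λ x₁ → Σ A λ x₂ → Σ A λ x₃ → Σ A λ x₄ →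
       v₁ ≡ inj₁ x₁ × v₂ ≡ inj₁ x₂ × v₃ ≡ inj₁ x₃ × v₄ ≡ inj₁ x₄)
    ⊎ (IsInj₂ v₁ ⊎ IsInj₂ v₂ ⊎ IsInj₂ v₃ ⊎ IsInj₂ v₄)
all-inj₁-or-some-inj₂ (inj₂ y) _ _ _ = inj₂ (inj₁ (y , refl))
all-inj₁-or-some-inj₂ (inj₁ _) (inj₂ y) _ _ = inj₂ (inj₂ (inj₁ (y , refl)))
all-inj₁-or-some-inj₂ (inj₁ _) (inj₁ _) (inj₂ y) _ = inj₂ (inj₂ (inj₂ (inj₁ (y , refl))))
all-inj₁-or-some-inj₂ (inj₁ _) (inj₁ _) (inj₁ _) (inj₂ y) = inj₂ (inj₂ (inj₂ (inj₂ (y , refl))))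
all-inj₁-or-some-inj₂ (inj₁ x₁) (inj₁ x₂) (inj₁ x₃) (inj₁ x₄) =
  inj₁ (x₁ , x₂ , x₃ , x₄ , refl , refl , refl , refl)

sumFin-cong : ∀ {k} {f g : Fin k → ℕ} → (∀ i → f i ≡ g i) → sumFin f ≡ sumFin g
sumFin-cong f≗g = cong sum (tabulate-cong f≗g)

sumFin-+ : ∀ {k} (f g : Fin k → ℕ) → sumFin (λ i → f i + g i) ≡ sumFin f + sumFin g
sumFin-+ {zero} f g = refl
sumFin-+ {suc k} f g = trans (cong (f zero + g zero +_) (sumFin-+ (f ∘ suc) (g ∘ suc)))
                             (interchange (f zero) (g zero) (sumFin (f ∘ suc)) (sumFin (g ∘ suc)))

sumFin-mono-≤ : ∀ {k} {f g : Fin k → ℕ} → (∀ i → f i ≤ g i) → sumFin f ≤ sumFin g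
sumFin-mono-≤ {zero} f≤g = z≤n
sumFin-mono-≤ {suc k} f≤g = +-mono-≤ (f≤g zero) (sumFin-mono-≤ (f≤g ∘ suc))

sumFin-inject₁-fromℕ : ∀ {k} (f : Fin (suc k) → ℕ) → sumFin f ≡ sumFin (f ∘ inject₁) + f (fromℕ k)
sumFin-inject₁-fromℕ {zero} f = +-comm (f zero) 0
sumFin-inject₁-fromℕ {suc k} f =
  trans (cong (f zero +_) (sumFin-inject₁-fromℕ (f ∘ suc))) (sym (+-assoc (f zero) _ _))

length-concat-tabulate : ∀ {k} {B : Set} (f : Fin k → List B)
  → length (concat (tabulate f)) ≡ sumFin (λ i → length (f i))
length-concat-tabulate {zero} f = refl
length-concat-tabulate {suc k} f =
  trans (length-++ (f zero)) (cong (length (f zero) +_) (length-concat-tabulate (f ∘ suc)))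

next-inject₁ : ∀ {k} (j : Fin k) → next {suc k} (inject₁ j) ≡ suc j
next-inject₁ {k} j = toℕ-injective (begin
  toℕ (next (inject₁ j))        ≡⟨ toℕ-fromℕ< _ ⟩
  suc (toℕ (inject₁ j)) % suc k ≡⟨ cong (λ t → suc t % suc k) (toℕ-inject₁ j) ⟩
  suc (toℕ j) % suc k           ≡⟨ m<n⇒m%n≡m (s≤s (toℕ<n j)) ⟩
  suc (toℕ j)                   ∎)
  where open ≡-Reasoning

next-fromℕ : ∀ {k} → next {suc k} (fromℕ k) ≡ zero
next-fromℕ {k} = toℕ-injective
  (trans (toℕ-fromℕ< _) (trans (cong (λ t → suc t % suc k) (toℕ-fromℕ k)) (n%n≡0 (suc k))))

sumFin-∘next : ∀ {k} (f : Fin (suc k) → ℕ) → sumFin (f ∘ next) ≡ sumFin f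
sumFin-∘next {k} f = begin
  sumFin (f ∘ next)                                ≡⟨ sumFin-inject₁-fromℕ (f ∘ next) ⟩
  sumFin (f ∘ next ∘ inject₁) + f (next (fromℕ k)) ≡⟨ cong₂ _+_ (sumFin-cong (cong f ∘ next-inject₁))
                                                                 (cong f next-fromℕ) ⟩
  sumFin (f ∘ suc) + f zero                        ≡⟨ +-comm (sumFin (f ∘ suc)) (f zero) ⟩
  sumFin f                                         ∎
  where open ≡-Reasoning

inject₁-or-fromℕ : ∀ {k} (i : Fin (suc k)) → (∃ λ j → i ≡ inject₁ j) ⊎ i ≡ fromℕ k
inject₁-or-fromℕ {zero} zero = inj₂ refl
inject₁-or-fromℕ {suc k} zero = inj₁ (zero , refl)
inject₁-or-fromℕ {suc k} (suc i) = Sum.map (λ (j , e) → suc j , cong suc e) (cong suc) (inject₁-or-fromℕ i)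

next-≢ : ∀ {k} (i : Fin (suc (suc k))) → next i ≢ i
next-≢ i next-i≡i with inject₁-or-fromℕ i
... | inj₁ (j , refl) =
  1+n≢n (trans (cong toℕ (trans (sym (next-inject₁ j)) next-i≡i)) (toℕ-inject₁ j))
... | inj₂ refl with trans (sym next-fromℕ) next-i≡i
... | ()

sumFin-≤-cyclic : ∀ {k} (c β α : Fin (suc k) → ℕ)
  → (∀ i → c i + β (next i) ≤ β i + α (next i)) → sumFin c ≤ sumFin α
sumFin-≤-cyclic c β α step = +-cancelʳ-≤ (sumFin β) (sumFin c) (sumFin α) (begin
  sumFin c + sumFin β                  ≡⟨ cong (sumFin c +_) (sym (sumFin-∘next β)) ⟩
  sumFin c + sumFin (β ∘ next)         ≡⟨ sym (sumFin-+ c (β ∘ next)) ⟩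
  sumFin (λ i → c i + β (next i))      ≤⟨ sumFin-mono-≤ step ⟩
  sumFin (λ i → β i + α (next i))      ≡⟨ sumFin-+ β (α ∘ next) ⟩
  sumFin β + sumFin (α ∘ next)         ≡⟨ cong (sumFin β +_) (sumFin-∘next α) ⟩
  sumFin β + sumFin α                  ≡⟨ +-comm (sumFin β) (sumFin α) ⟩
  sumFin α + sumFin β                  ∎)
  where open ≤-Reasoning

module IndependentSet {n : ℕ} (a b : Fin (suc (suc n)) → ℕ)
  (G : (i : Fin (suc (suc n))) → Graph4 (Fin (a i) ⊎ Fin (b i)))
  (S : List (Circular.VC a b G)) (S-unique : Unique S)
  (S-free : ¬ ContainsEdge (Circular.EC a b G) S) where

  open Circular a b G

  _≟ᵛ_ : DecidableEquality VC
  _≟ᵛ_ = Product.≡-dec _≟ᶠ_ (Product.≡-dec _≟ᶠ_ _≟ᶠ_)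

  open import Data.List.Membership.DecPropositional _≟ᵛ_ using (_∈?_)

  InS : ∀ i → Fin (a i) → Fin (b (next i)) → Set
  InS i x y = (i , x , y) ∈ S

  InS? : ∀ i x y → Dec (InS i x y)
  InS? i x y = (i , x , y) ∈? S

  -- used i is X_i and β i is β_i(S).
  used : ∀ i → List (Fin (a i))
  used i = filter (λ x → any? (InS? i x)) (allFin (a i))

  β : Fin (suc (suc n)) → ℕ
  β i = length (used i)

  ∈-used⁻ : ∀ i {x} → x ∈ used i → ∃ (InS i x)
  ∈-used⁻ i x∈ = proj₂ (∈-filter⁻ (λ x → any? (InS? i x)) {xs = allFin (a i)} x∈)

  ∈-used⁺ : ∀ i {x y} → InS i x y → x ∈ used i
  ∈-used⁺ i {x} {y} xy∈S = ∈-filter⁺ (λ x → any? (InS? i x)) (∈-allFin x) (y , xy∈S)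

  used-unique : ∀ i → Unique (used i)
  used-unique i = Unique.filter⁺ (λ x → any? (InS? i x)) {xs = allFin (a i)} (Unique.allFin⁺ _)

  ≢-fst : ∀ {i x x′ y y′} → x ≢ x′ → _≢_ {A = VC} (i , x , y) (i , x′ , y′)
  ≢-fst x≢x′ refl = x≢x′ refl

  ≢-snd : ∀ {i x x′ y y′} → y ≢ y′ → _≢_ {A = VC} (i , x , y) (i , x′ , y′)
  ≢-snd y≢y′ refl = y≢y′ refl

  used-free : ∀ i → ¬ ContainsEdge (inducedLeft (G i)) (used i)
  used-free i (x₁ , x₂ , x₃ , x₄ , m₁ , m₂ , m₃ , m₄ , d@(d₁₂ , d₁₃ , d₁₄ , d₂₃ , d₂₄ , d₃₄) , e)
    with ∈-used⁻ i m₁ | ∈-used⁻ i m₂ | ∈-used⁻ i m₃ | ∈-used⁻ i m₄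
  ... | y₁ , s₁ | y₂ , s₂ | y₃ , s₃ | y₄ , s₄ =
    S-free (_ , _ , _ , _ , s₁ , s₂ , s₃ , s₄ ,
            (≢-fst d₁₂ , ≢-fst d₁₃ , ≢-fst d₁₄ , ≢-fst d₂₃ , ≢-fst d₂₄ , ≢-fst d₃₄) ,
            inj₂ (inj₂ (i , x₁ , x₂ , x₃ , x₄ , y₁ , y₂ , y₃ , y₄ , refl , refl , refl , refl , d , e)))

  Branching : ∀ i → Fin (a i) → Set
  Branching i x = ∃₂ λ y y′ → y ≢ y′ × InS i x y × InS i x y′

  branching? : ∀ i x → Dec (Branching i x)
  branching? i x = any? λ y → any? λ y′ → ¬? (y ≟ᶠ y′) ×-dec InS? i x y ×-dec InS? i x y′

  branching-unique : ∀ i {x x′} → Branching i x → Branching i x′ → x ≡ x′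
  branching-unique i {x} {x′} (y₁ , y₂ , y₁≢y₂ , s₁ , s₂) (y₃ , y₄ , y₃≢y₄ , s₃ , s₄) with x ≟ᶠ x′
  ... | yes x≡x′ = x≡x′
  ... | no x≢x′ = ⊥-elim (S-free (_ , _ , _ , _ , s₁ , s₂ , s₃ , s₄ ,
          (≢-snd y₁≢y₂ , ≢-fst x≢x′ , ≢-fst x≢x′ , ≢-fst x≢x′ , ≢-fst x≢x′ , ≢-snd y₃≢y₄) ,
          inj₂ (inj₁ (i , x , x′ , y₁ , y₂ , y₃ , y₄ , x≢x′ , refl , refl , refl , refl))))

  partners : ∀ i → Fin (a i) → List (Fin (b (next i)))
  partners i x = filter (InS? i x) (allFin _)

  link : ∀ i → Fin (a i) → List (Fin (a (next i)) ⊎ Fin (b (next i)))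
  link i x = map inj₂ (partners i x) ++ map inj₁ (used (next i))

  InLink : ∀ i → Fin (a i) → Fin (a (next i)) ⊎ Fin (b (next i)) → Set
  InLink i x (inj₁ x′) = x′ ∈ used (next i)
  InLink i x (inj₂ y) = InS i x y

  ∈-link⁻ : ∀ i x {v} → v ∈ link i x → InLink i x v
  ∈-link⁻ i x v∈ with ∈-++⁻ (map inj₂ (partners i x)) v∈
  ... | inj₁ v∈₂ with ∈-map⁻ inj₂ v∈₂
  ...   | y , y∈ , refl = proj₂ (∈-filter⁻ (InS? i x) {xs = allFin _} y∈)
  ∈-link⁻ i x v∈ | inj₂ v∈₁ with ∈-map⁻ inj₁ v∈₁
  ...   | x′ , x′∈ , refl = x′∈

  link-unique : ∀ i x → Unique (link i x)
  link-unique i x = Unique.++⁺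
    (Unique.map⁺ Sum.inj₂-injective (Unique.filter⁺ (InS? i x) {xs = allFin _} (Unique.allFin⁺ _)))
    (Unique.map⁺ Sum.inj₁-injective (used-unique (next i)))
    disjoint
    where
    disjoint : ∀ {v} → ¬ (v ∈ map inj₂ (partners i x) × v ∈ map inj₁ (used (next i)))
    disjoint (v∈₂ , v∈₁) with ∈-map⁻ inj₂ v∈₂ | ∈-map⁻ inj₁ v∈₁
    ... | _ , _ , refl | _ , _ , ()

  length-link : ∀ i x → length (link i x) ≡ length (partners i x) + β (next i)
  length-link i x = length-map-++-map inj₂ inj₁ (partners i x) (used (next i))

  emb-injective : ∀ i {u u′ : Pair i} → emb i u ≡ emb i u′ → u ≡ u′
  emb-injective i {inj₁ _} {inj₁ _} refl = refl
  emb-injective i {inj₂ _} {inj₂ _} refl = refl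
  emb-injective i {inj₁ _} {inj₂ _} eq = ⊥-elim (next-≢ i (sym (cong proj₁ eq)))
  emb-injective i {inj₂ _} {inj₁ _} eq = ⊥-elim (next-≢ i (cong proj₁ eq))

  -- A vertex of link i x is the h_i-image of a vertex of S ∩ (W_i ∪ W_{i+1}).
  module Lift (i : Fin (suc (suc n))) (x : Fin (a i)) where

    lift : ∀ v → InLink i x v → Pair i
    lift (inj₁ x′) x′∈ = inj₂ (x′ , proj₁ (∈-used⁻ (next i) x′∈))
    lift (inj₂ y) _ = inj₁ (x , y)

    h-lift : ∀ v l → h i (lift v l) ≡ v
    h-lift (inj₁ _) _ = refl
    h-lift (inj₂ _) _ = refl

    lift-∈ : ∀ v l → emb i (lift v l) ∈ S
    lift-∈ (inj₁ _) x′∈ = proj₂ (∈-used⁻ (next i) x′∈)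
    lift-∈ (inj₂ _) xy∈S = xy∈S

    xOf-lift : ∀ v l → xOf i (lift v l) ≡ nothing ⊎ xOf i (lift v l) ≡ just x
    xOf-lift (inj₁ _) _ = inj₁ refl
    xOf-lift (inj₂ _) _ = inj₂ refl

    xOf-lift-inj₂ : ∀ v l → IsInj₂ v → xOf i (lift v l) ≡ just x
    xOf-lift-inj₂ (inj₂ _) _ _ = refl

    lift-≢ : ∀ {v v′} l l′ → v ≢ v′ → emb i (lift v l) ≢ emb i (lift v′ l′)
    lift-≢ {v} {v′} l l′ v≢v′ eq =
      v≢v′ (trans (sym (h-lift v l)) (trans (cong (h i) (emb-injective i eq)) (h-lift v′ l′)))

  link-free : ∀ i x → ¬ ContainsEdge (Edge (G (next i))) (link i x)
  link-free i x (v₁ , v₂ , v₃ , v₄ , m₁ , m₂ , m₃ , m₄ , (d₁₂ , d₁₃ , d₁₄ , d₂₃ , d₂₄ , d₃₄) , e)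
    with all-inj₁-or-some-inj₂ v₁ v₂ v₃ v₄
  ... | inj₁ (x₁ , x₂ , x₃ , x₄ , refl , refl , refl , refl) =
    used-free (next i) (x₁ , x₂ , x₃ , x₄ , l₁ , l₂ , l₃ , l₄ ,
      (d₁₂ ∘ cong inj₁ , d₁₃ ∘ cong inj₁ , d₁₄ ∘ cong inj₁ ,
       d₂₃ ∘ cong inj₁ , d₂₄ ∘ cong inj₁ , d₃₄ ∘ cong inj₁) , e)
    where
    l₁ = ∈-link⁻ i x m₁
    l₂ = ∈-link⁻ i x m₂
    l₃ = ∈-link⁻ i x m₃
    l₄ = ∈-link⁻ i x m₄
  ... | inj₂ some-inj₂ =
    S-free (emb i u₁ , emb i u₂ , emb i u₃ , emb i u₄ ,
            lift-∈ v₁ l₁ , lift-∈ v₂ l₂ , lift-∈ v₃ l₃ , lift-∈ v₄ l₄ ,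
            (lift-≢ l₁ l₂ d₁₂ , lift-≢ l₁ l₃ d₁₃ , lift-≢ l₁ l₄ d₁₄ ,
             lift-≢ l₂ l₃ d₂₃ , lift-≢ l₂ l₄ d₂₄ , lift-≢ l₃ l₄ d₃₄) ,
            inj₁ (i , u₁ , u₂ , u₃ , u₄ , refl , refl , refl , refl , β≡1-lifts ,
                  subst₄ (Edge (G (next i))) (sym (h-lift v₁ l₁)) (sym (h-lift v₂ l₂))
                         (sym (h-lift v₃ l₃)) (sym (h-lift v₄ l₄)) e))
    where
    open Lift i x
    l₁ = ∈-link⁻ i x m₁
    l₂ = ∈-link⁻ i x m₂
    l₃ = ∈-link⁻ i x m₃
    l₄ = ∈-link⁻ i x m₄
    u₁ = lift v₁ l₁
    u₂ = lift v₂ l₂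
    u₃ = lift v₃ l₃
    u₄ = lift v₄ l₄
    β≡1-lifts : β≡1 i u₁ u₂ u₃ u₄
    β≡1-lifts = x , Sum.map (xOf-lift-inj₂ v₁ l₁) (Sum.map (xOf-lift-inj₂ v₂ l₂)
                      (Sum.map (xOf-lift-inj₂ v₃ l₃) (xOf-lift-inj₂ v₄ l₄))) some-inj₂ ,
                xOf-lift v₁ l₁ , xOf-lift v₂ l₂ , xOf-lift v₃ l₃ , xOf-lift v₄ l₄

  Code : Set
  Code = Σ (Fin (suc (suc n))) λ i → Fin (a i) ⊎ Fin (b (next i))

  _≟ᶜ_ : DecidableEquality Code
  _≟ᶜ_ = Product.≡-dec _≟ᶠ_ (Sum.≡-dec _≟ᶠ_ _≟ᶠ_)

  tag : ∀ i → Fin (a i) ⊎ Fin (b (next i)) → Code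
  tag i z = i , z

  -- Since at most one x ∈ V_i' is branching, recording only y for it keeps encode injective on S.
  code : ∀ {i x} → Dec (Branching i x) → Fin (b (next i)) → Fin (a i) ⊎ Fin (b (next i))
  code (yes _) y = inj₂ y
  code {x = x} (no _) _ = inj₁ x

  encode : VC → Code
  encode (i , x , y) = tag i (code (branching? i x) y)

  code-injectiveOn : ∀ {i i′ x x′ y y′} (d : Dec (Branching i x)) (d′ : Dec (Branching i′ x′))
    → InS i x y → InS i′ x′ y′ → tag i (code d y) ≡ tag i′ (code d′ y′)
    → _≡_ {A = VC} (i , x , y) (i′ , x′ , y′)
  code-injectiveOn {i} {y = y} (yes p) (yes p′) _ _ refl = cong (λ x → i , x , y) (branching-unique i p p′)
  code-injectiveOn {i} {x = x} {y = y} {y′ = y′} (no ¬p) (no _) s s′ refl with y ≟ᶠ y′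
  ... | yes y≡y′ = cong (λ y → i , x , y) y≡y′
  ... | no y≢y′ = ⊥-elim (¬p (y , y′ , y≢y′ , s , s′))

  encode-injectiveOn : ∀ {u v} → u ∈ S → v ∈ S → encode u ≡ encode v → u ≡ v
  encode-injectiveOn {i , x , _} {i′ , x′ , _} = code-injectiveOn (branching? i x) (branching? i′ x′)

  unbranched : ∀ i → List (Fin (a i))
  unbranched i = filter (λ x → ¬? (branching? i x)) (used i)

  codesWith : ∀ i → Dec (∃ (Branching i)) → List (Fin (a i) ⊎ Fin (b (next i)))
  codesWith i (yes (x* , _)) = map inj₁ (unbranched i) ++ map inj₂ (partners i x*)
  codesWith i (no _) = map inj₁ (used i)

  codes : ∀ i → List (Fin (a i) ⊎ Fin (b (next i)))
  codes i = codesWith i (any? (branching? i))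

  code-∈-codesWith : ∀ {i x y} → InS i x y
    → (d : Dec (Branching i x)) (D : Dec (∃ (Branching i))) → code d y ∈ codesWith i D
  code-∈-codesWith {i} {x} {y} s (yes p) (yes (x* , p*)) =
    ∈-++⁺ʳ (map inj₁ (unbranched i)) (∈-map⁺ inj₂
      (∈-filter⁺ (InS? i x*) (∈-allFin y) (subst (λ x → InS i x y) (branching-unique i p p*) s)))
  code-∈-codesWith {x = x} s (yes p) (no ¬∃) = ⊥-elim (¬∃ (x , p))
  code-∈-codesWith {i} s (no ¬p) (yes _) =
    ∈-++⁺ˡ (∈-map⁺ inj₁ (∈-filter⁺ (λ x → ¬? (branching? i x)) (∈-used⁺ i s) ¬p))
  code-∈-codesWith {i} s (no _) (no _) = ∈-map⁺ inj₁ (∈-used⁺ i s)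

  encode-∈ : ∀ {u} → u ∈ S → encode u ∈ concat (tabulate (λ i → map (tag i) (codes i)))
  encode-∈ {i , x , y} s =
    ∈-concat⁺′ (∈-map⁺ (tag i) (code-∈-codesWith s (branching? i x) (any? (branching? i))))
               (∈-tabulate⁺ {f = λ i → map (tag i) (codes i)} i)

  length-S : length S ≤ sumFin (λ i → length (codes i))
  length-S = begin
    length S
      ≤⟨ length-≤-of-injectiveOn _≟ᶜ_ encode S _ S-unique encode-injectiveOn encode-∈ ⟩
    length (concat (tabulate (λ i → map (tag i) (codes i))))
      ≡⟨ length-concat-tabulate (λ i → map (tag i) (codes i)) ⟩
    sumFin (λ i → length (map (tag i) (codes i)))
      ≡⟨ sumFin-cong (λ i → length-map (tag i) (codes i)) ⟩
    sumFin (λ i → length (codes i)) ∎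
    where open ≤-Reasoning

  length-unbranched : ∀ i {x} → Branching i x → suc (length (unbranched i)) ≤ β i
  length-unbranched i p@(_ , _ , _ , s , _) =
    filter-notAll (λ x → ¬? (branching? i x)) (used i) (Any.map (λ { refl ¬p → ¬p p }) (∈-used⁺ i s))

  module _ (α : Fin (suc (suc n)) → ℕ) (β≤α : ∀ i → β i ≤ α i)
           (link≤ : ∀ i x → length (partners i x) + β (next i) ≤ suc (α (next i))) where

    length-codesWith : ∀ i D → length (codesWith i D) + β (next i) ≤ β i + α (next i)
    length-codesWith i (no _) = begin
      length (map inj₁ (used i)) + β (next i) ≡⟨ cong (_+ β (next i)) (length-map inj₁ (used i)) ⟩
      β i + β (next i)                        ≤⟨ +-monoʳ-≤ (β i) (β≤α (next i)) ⟩
      β i + α (next i)                        ∎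
      where open ≤-Reasoning
    length-codesWith i (yes (x* , p)) = begin
      length (codesWith i (yes (x* , p))) + β (next i)
        ≡⟨ cong (_+ β (next i)) (length-map-++-map inj₁ inj₂ (unbranched i) (partners i x*)) ⟩
      length (unbranched i) + length (partners i x*) + β (next i)
        ≡⟨ +-assoc (length (unbranched i)) _ _ ⟩
      length (unbranched i) + (length (partners i x*) + β (next i))
        ≤⟨ +-monoʳ-≤ (length (unbranched i)) (link≤ i x*) ⟩
      length (unbranched i) + suc (α (next i))
        ≡⟨ +-suc (length (unbranched i)) _ ⟩
      suc (length (unbranched i)) + α (next i)
        ≤⟨ +-monoˡ-≤ (α (next i)) (length-unbranched i p) ⟩
      β i + α (next i) ∎
      where open ≤-Reasoning

    length-S≤ : length S ≤ sumFin α
    length-S≤ = ≤-trans length-S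
      (sumFin-≤-cyclic (λ i → length (codes i)) β α (λ i → length-codesWith i (any? (branching? i))))

theorem1 : (m : ℕ) → 2 ≤ m → (a b : Fin m → ℕ)
    → (G : (i : Fin m) → Graph4 (Fin (a i) ⊎ Fin (b i)))
    → (α : Fin m → ℕ)
    → ((i : Fin m) → αEq (Edge (G i)) (suc (α i)) × αLe (inducedLeft (G i)) (α i))
    → αLe (Circular.EC a b G) (sumFin α)
theorem1 (suc (suc n)) (s≤s (s≤s z≤n)) a b G α hyp S (S-unique , S-free) = length-S≤ α β≤α link≤
  where
  open IndependentSet a b G S S-unique S-free
  β≤α : ∀ i → β i ≤ α i
  β≤α i = proj₂ (hyp i) (used i) (used-unique i , used-free i)
  link≤ : ∀ i x → length (partners i x) + β (next i) ≤ suc (α (next i))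
  link≤ i x = subst (_≤ suc (α (next i))) (length-link i x)
                    (proj₂ (proj₁ (hyp (next i))) (link i x) (link-unique i x , link-free i x))
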